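{- For each $n<\omega$ and all $A,B\in\mathcal{F}^\nabla_n$: $\Diamond_nA\vdash\Diamond_nB$ is provable in $\mathrm{RC}^\nabla$ if and only if $A\vdash\nabla_nB$ is provable in $\mathrm{RC}^\nabla$.
   Context: Strictly positive formulas are built from propositional variables and $\top$ by $\land$ and unary modalities $\Diamond_n,\nabla_n$ ($n<\omega$). $\mathcal{F}^\nabla_n$ is the set of variable-free strictly positive formulas using only modalities $\Diamond_i,\nabla_i$ with $i\ge n$. $\mathrm{RC}^\nabla$ is the smallest set of sequents $A\vdash B$ containing the following axioms and closed under the following rules and under substitution: (1) $A\vdash A$; $A\vdash\top$; $A\land B\vdash A$; $A\land B\vdash B$; from $A\vdash B$, $B\vdash C$ infer $A\vdash C$; from $A\vdash B$, $A\vdash C$ infer $A\vdash B\land C$; from $A\vdash B$ infer $aA\vdash aB$ for each modality $a$; (2) $aaA\vdash aA$ for each modality $a$; (3) for $m<n$: $\Diamond_nA\vdash\Diamond_mA$, $\Diamond_nA\land\Diamond_mB\vdash\Diamond_n(A\land\Diamond_mB)$, and the same two with $\nabla$ in place of $\Diamond$; (4) $A\vdash\nabla_nA$, $\Diamond_nA\vdash\nabla_nA$; (5) for $m\le n$: $\Diamond_m\nabla_nA\vdash\Diamond_mA$, $\nabla_n\Diamond_mA\vdash\Diamond_mA$. -}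

module Defs where

open import Data.Nat using (ℕ; _<_; _≤_)

data Modality : Set where
  ◇ : ℕ → Modality
  ∇ : ℕ → Modality

idx : Modality → ℕ
idx (◇ n) = n
idx (∇ n) = n

data Fm : Set where
  var : ℕ → Fm
  ⊤'  : Fm
  _∧'_ : Fm → Fm → Fm
  _[_] : Modality → Fm → Fm

infixr 6 _∧'_

◇[_]_ : ℕ → Fm → Fm
◇[ n ] A = ◇ n [ A ]

∇[_]_ : ℕ → Fm → Fm
∇[ n ] A = ∇ n [ A ]

subst : (ℕ → Fm) → Fm → Fm
subst σ (var x) = σ x
subst σ ⊤' = ⊤'
subst σ (A ∧' B) = subst σ A ∧' subst σ B
subst σ (a [ A ]) = a [ subst σ A ]

-- F^∇_n : variable-free formulas using only modalities with index ≥ n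
data InF : ℕ → Fm → Set where
  top : ∀ {n} → InF n ⊤'
  and : ∀ {n A B} → InF n A → InF n B → InF n (A ∧' B)
  mod : ∀ {n a A} → n ≤ idx a → InF n A → InF n (a [ A ])

-- The calculus RC^∇ : the smallest set of sequents closed under the
-- axioms and rules below, including closure under substitution.
infix 4 _⊢_
data _⊢_ : Fm → Fm → Set where
  refl⊢  : ∀ {A} → A ⊢ A
  top⊢   : ∀ {A} → A ⊢ ⊤'
  ∧E₁    : ∀ {A B} → A ∧' B ⊢ A
  ∧E₂    : ∀ {A B} → A ∧' B ⊢ B
  cut    : ∀ {A B C} → A ⊢ B → B ⊢ C → A ⊢ C
  ∧I     : ∀ {A B C} → A ⊢ B → A ⊢ C → A ⊢ B ∧' C
  mono   : ∀ {A B} (a : Modality) → A ⊢ B → a [ A ] ⊢ a [ B ]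
  trans4 : ∀ {A} (a : Modality) → a [ a [ A ] ] ⊢ a [ A ]
  ◇mono  : ∀ {m n A} → m < n → ◇[ n ] A ⊢ ◇[ m ] A
  ◇J     : ∀ {m n A B} → m < n → ◇[ n ] A ∧' ◇[ m ] B ⊢ ◇[ n ] (A ∧' ◇[ m ] B)
  ∇mono  : ∀ {m n A} → m < n → ∇[ n ] A ⊢ ∇[ m ] A
  ∇J     : ∀ {m n A B} → m < n → ∇[ n ] A ∧' ∇[ m ] B ⊢ ∇[ n ] (A ∧' ∇[ m ] B)
  ∇refl  : ∀ {n A} → A ⊢ ∇[ n ] A
  ◇∇     : ∀ {n A} → ◇[ n ] A ⊢ ∇[ n ] A
  ◇∇◇    : ∀ {m n A} → m ≤ n → ◇[ m ] (∇[ n ] A) ⊢ ◇[ m ] A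
  ∇◇◇    : ∀ {m n A} → m ≤ n → ∇[ n ] (◇[ m ] A) ⊢ ◇[ m ] A
  sub    : ∀ {A B} (σ : ℕ → Fm) → A ⊢ B → subst σ A ⊢ subst σ B

-- Read formulas in a model in which ◇ₖ C holds for k < n, and ◇ₙ C holds when
-- erase A ⊢ erase (∇ₙ C), where erase deletes every modality of index below n.
-- Erasure is a sound translation of RC^∇, so this model is closed under
-- derivability and validates ◇ₙ A; hence ◇ₙ A ⊢ ◇ₙ B gives
-- erase A ⊢ ∇ₙ (erase B), which is A ⊢ ∇ₙ B because erasure fixes F^∇ₙ.
-- Conversely ◇ₙ A ⊢ ◇ₙ ∇ₙ B ⊢ ◇ₙ B.
module Submission where

open import Defs
open import Data.Nat using (ℕ; _<_; _≤_; _<?_)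
open import Data.Nat.Properties using (<-trans; <-irrefl; ≤-<-trans; ≤-refl; ≤⇒≯; m≤n⇒m<n∨m≡n)
open import Data.Empty using (⊥; ⊥-elim)
open import Data.Unit using (⊤; tt)
open import Data.Product as Prod using (_×_; _,_)
open import Data.Sum as Sum using (_⊎_; inj₁; inj₂)
open import Relation.Nullary using (Dec; yes; no; contradiction)
open import Relation.Binary.PropositionalEquality
  using (_≡_; refl; sym; trans; cong; cong₂; subst₂) renaming (subst to ≡-subst)

subst-∘ : ∀ (σ τ : ℕ → Fm) C → subst σ (subst τ C) ≡ subst (λ x → subst σ (τ x)) C
subst-∘ σ τ (var x) = refl
subst-∘ σ τ ⊤' = refl
subst-∘ σ τ (C ∧' D) = cong₂ _∧'_ (subst-∘ σ τ C) (subst-∘ σ τ D)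
subst-∘ σ τ (a [ C ]) = cong (a [_]) (subst-∘ σ τ C)

subst-var : ∀ C → subst var C ≡ C
subst-var (var x) = refl
subst-var ⊤' = refl
subst-var (C ∧' D) = cong₂ _∧'_ (subst-var C) (subst-var D)
subst-var (a [ C ]) = cong (a [_]) (subst-var C)

∇-antitone : ∀ {m k C} → m ≤ k → ∇[ k ] C ⊢ ∇[ m ] C
∇-antitone m≤k with m≤n⇒m<n∨m≡n m≤k
... | inj₁ m<k = ∇mono m<k
... | inj₂ refl = refl⊢

∇◇⊢∇ : ∀ {n C} → ∇[ n ] (◇[ n ] C) ⊢ ∇[ n ] C
∇◇⊢∇ = cut (∇◇◇ ≤-refl) ◇∇

∇◇J : ∀ {m k C D} → m < k → ∇[ k ] C ∧' ◇[ m ] D ⊢ ∇[ k ] (C ∧' ◇[ m ] D)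
∇◇J m<k = cut (∧I ∧E₁ (cut ∧E₂ ∇refl))
              (cut (∇J m<k) (mono (∇ _) (∧I ∧E₁ (cut ∧E₂ (∇◇◇ ≤-refl)))))

module Erasure (n : ℕ) where

  -- Taking the decision as an argument lets a single `with idx a <? n` reduce
  -- every occurrence of it, e.g. both layers of erase (a [ a [ C ] ]).
  eraseMod : ∀ {k} → Dec (k < n) → Modality → Fm → Fm
  eraseMod (yes _) a X = ⊤'
  eraseMod (no _) a X = a [ X ]

  erase : Fm → Fm
  erase (var x) = var x
  erase ⊤' = ⊤'
  erase (C ∧' D) = erase C ∧' erase D
  erase (a [ C ]) = eraseMod (idx a <? n) a (erase C)

  erase-low : ∀ {a C X} → idx a < n → X ⊢ erase (a [ C ])
  erase-low {a} a<n with idx a <? n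
  ... | yes _ = top⊢
  ... | no a≮n = contradiction a<n a≮n

  erase-high : ∀ {a C} → n ≤ idx a → erase (a [ C ]) ≡ a [ erase C ]
  erase-high {a} n≤a with idx a <? n
  ... | yes a<n = contradiction a<n (≤⇒≯ n≤a)
  ... | no _ = refl

  erase-InF : ∀ {C} → InF n C → erase C ≡ C
  erase-InF top = refl
  erase-InF (and C∈F D∈F) = cong₂ _∧'_ (erase-InF C∈F) (erase-InF D∈F)
  erase-InF (mod {a = a} {A = C} n≤a C∈F) = trans (erase-high {C = C} n≤a) (cong (a [_]) (erase-InF C∈F))

  erase-subst : ∀ σ C → erase (subst σ C) ≡ subst (λ x → erase (σ x)) (erase C)
  erase-subst σ (var x) = refl
  erase-subst σ ⊤' = refl
  erase-subst σ (C ∧' D) = cong₂ _∧'_ (erase-subst σ C) (erase-subst σ D)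
  erase-subst σ (a [ C ]) with idx a <? n
  ... | yes _ = refl
  ... | no _ = cong (a [_]) (erase-subst σ C)

  erase-sound : ∀ {C D} → C ⊢ D → erase C ⊢ erase D
  erase-sound refl⊢ = refl⊢
  erase-sound top⊢ = top⊢
  erase-sound ∧E₁ = ∧E₁
  erase-sound ∧E₂ = ∧E₂
  erase-sound (cut d e) = cut (erase-sound d) (erase-sound e)
  erase-sound (∧I d e) = ∧I (erase-sound d) (erase-sound e)
  erase-sound (mono a d) with idx a <? n
  ... | yes _ = refl⊢
  ... | no _ = mono a (erase-sound d)
  erase-sound (trans4 {C} a) with idx a <? n
  ... | yes _ = refl⊢
  ... | no _ = trans4 a
  erase-sound (◇mono {m} {k} m<k) with m <? n | k <? n
  ... | yes _ | _ = top⊢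
  ... | no m≮n | yes k<n = contradiction (<-trans m<k k<n) m≮n
  ... | no _ | no _ = ◇mono m<k
  erase-sound (∇mono {m} {k} m<k) with m <? n | k <? n
  ... | yes _ | _ = top⊢
  ... | no m≮n | yes k<n = contradiction (<-trans m<k k<n) m≮n
  ... | no _ | no _ = ∇mono m<k
  erase-sound (◇J {m} {k} m<k) with k <? n | m <? n
  ... | yes _ | _ = top⊢
  ... | no _ | yes _ = cut ∧E₁ (mono (◇ k) (∧I refl⊢ top⊢))
  ... | no _ | no _ = ◇J m<k
  erase-sound (∇J {m} {k} m<k) with k <? n | m <? n
  ... | yes _ | _ = top⊢
  ... | no _ | yes _ = cut ∧E₁ (mono (∇ k) (∧I refl⊢ top⊢))
  ... | no _ | no _ = ∇J m<k
  erase-sound (∇refl {k}) with k <? n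
  ... | yes _ = top⊢
  ... | no _ = ∇refl
  erase-sound (◇∇ {k}) with k <? n
  ... | yes _ = top⊢
  ... | no _ = ◇∇
  erase-sound (◇∇◇ {m} {k} m≤k) with m <? n | k <? n
  ... | yes _ | _ = top⊢
  ... | no m≮n | yes k<n = contradiction (≤-<-trans m≤k k<n) m≮n
  ... | no _ | no _ = ◇∇◇ m≤k
  erase-sound (∇◇◇ {m} {k} m≤k) with m <? n | k <? n
  ... | yes _ | _ = top⊢
  ... | no m≮n | yes k<n = contradiction (≤-<-trans m≤k k<n) m≮n
  ... | no _ | no _ = ∇◇◇ m≤k
  erase-sound (sub {C} {D} σ d) rewrite erase-subst σ C | erase-subst σ D =
    sub (λ x → erase (σ x)) (erase-sound d)

module Model (n : ℕ) (A : Fm) where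

  open Erasure n

  record Reach (C : Fm) : Set where
    constructor reach
    field reached : erase A ⊢ erase (∇[ n ] C)

  Reach-join : ∀ {C D} E → ∇[ n ] C ∧' E ⊢ ∇[ n ] D → erase A ⊢ erase E → Reach C → Reach D
  Reach-join E d e (reach r) = reach (cut (∧I r e) (erase-sound d))

  Reach-post : ∀ {C D} → ∇[ n ] C ⊢ ∇[ n ] D → Reach C → Reach D
  Reach-post d = Reach-join ⊤' (cut ∧E₁ d) top⊢

  Holds : Fm → Set
  Holds (var x) = ⊥
  Holds ⊤' = ⊤
  Holds (C ∧' D) = Holds C × Holds D
  Holds (◇ k [ C ]) = k < n ⊎ (k ≡ n × Reach C)
  Holds (∇ k [ C ]) = k < n ⊎ Holds C ⊎ (k ≡ n × Reach C)

  Holds-sound : ∀ {C D} → C ⊢ D → (σ : ℕ → Fm) → Holds (subst σ C) → Holds (subst σ D)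
  Holds-sound refl⊢ σ h = h
  Holds-sound top⊢ σ h = tt
  Holds-sound ∧E₁ σ (h , _) = h
  Holds-sound ∧E₂ σ (_ , h) = h
  Holds-sound (cut d e) σ h = Holds-sound e σ (Holds-sound d σ h)
  Holds-sound (∧I d e) σ h = Holds-sound d σ h , Holds-sound e σ h
  Holds-sound (mono (◇ k) d) σ =
    Sum.map₂ (Prod.map₂ (Reach-post (mono (∇ n) (sub σ d))))
  Holds-sound (mono (∇ k) d) σ =
    Sum.map₂ (Sum.map (Holds-sound d σ) (Prod.map₂ (Reach-post (mono (∇ n) (sub σ d)))))
  Holds-sound (trans4 (◇ k)) σ (inj₁ k<n) = inj₁ k<n
  Holds-sound (trans4 (◇ k)) σ (inj₂ (refl , r)) = inj₂ (refl , Reach-post ∇◇⊢∇ r)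
  Holds-sound (trans4 (∇ k)) σ (inj₁ k<n) = inj₁ k<n
  Holds-sound (trans4 (∇ k)) σ (inj₂ (inj₁ h)) = h
  Holds-sound (trans4 (∇ k)) σ (inj₂ (inj₂ (refl , r))) =
    inj₂ (inj₂ (refl , Reach-post (trans4 (∇ n)) r))
  Holds-sound (◇mono m<k) σ (inj₁ k<n) = inj₁ (<-trans m<k k<n)
  Holds-sound (◇mono m<k) σ (inj₂ (refl , _)) = inj₁ m<k
  Holds-sound (∇mono m<k) σ (inj₁ k<n) = inj₁ (<-trans m<k k<n)
  Holds-sound (∇mono m<k) σ (inj₂ (inj₁ h)) = inj₂ (inj₁ h)
  Holds-sound (∇mono m<k) σ (inj₂ (inj₂ (refl , _))) = inj₁ m<k
  Holds-sound (◇J m<k) σ (inj₁ k<n , _) = inj₁ k<n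
  Holds-sound (◇J {B = D} m<k) σ (inj₂ (refl , r) , _) =
    inj₂ (refl , Reach-join _ (∇◇J m<k) (erase-low {C = subst σ D} m<k) r)
  Holds-sound (∇J m<k) σ (inj₁ k<n , _) = inj₁ k<n
  Holds-sound (∇J m<k) σ (inj₂ (inj₁ h) , h′) = inj₂ (inj₁ (h , h′))
  Holds-sound (∇J {B = D} m<k) σ (inj₂ (inj₂ (refl , r)) , _) =
    inj₂ (inj₂ (refl , Reach-join _ (∇J m<k) (erase-low {C = subst σ D} m<k) r))
  Holds-sound ∇refl σ h = inj₂ (inj₁ h)
  Holds-sound ◇∇ σ = Sum.map₂ inj₂
  Holds-sound (◇∇◇ m≤k) σ (inj₁ m<n) = inj₁ m<n
  Holds-sound (◇∇◇ m≤k) σ (inj₂ (refl , r)) =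
    inj₂ (refl , Reach-post (cut (mono (∇ n) (∇-antitone m≤k)) (trans4 (∇ n))) r)
  Holds-sound (∇◇◇ m≤k) σ (inj₁ k<n) = inj₁ (≤-<-trans m≤k k<n)
  Holds-sound (∇◇◇ m≤k) σ (inj₂ (inj₁ h)) = h
  Holds-sound (∇◇◇ m≤k) σ (inj₂ (inj₂ (refl , r))) with m≤n⇒m<n∨m≡n m≤k
  ... | inj₁ m<n = inj₁ m<n
  ... | inj₂ refl = inj₂ (refl , Reach-post ∇◇⊢∇ r)
  Holds-sound (sub {C} {D} τ d) σ h
    rewrite subst-∘ σ τ C | subst-∘ σ τ D = Holds-sound d (λ x → subst σ (τ x)) h

  Holds-closed : ∀ {C D} → C ⊢ D → Holds C → Holds D
  Holds-closed {C} {D} d h =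
    ≡-subst Holds (subst-var D) (Holds-sound d var (≡-subst Holds (sym (subst-var C)) h))

  Holds-◇⇒Reach : ∀ {C} → Holds (◇[ n ] C) → Reach C
  Holds-◇⇒Reach (inj₁ n<n) = ⊥-elim (<-irrefl refl n<n)
  Holds-◇⇒Reach (inj₂ (_ , r)) = r

  ◇⊢◇⇒Reach : ∀ {B} → ◇[ n ] A ⊢ ◇[ n ] B → Reach B
  ◇⊢◇⇒Reach d = Holds-◇⇒Reach (Holds-closed d (inj₂ (refl , reach (erase-sound (∇refl {n} {A})))))

◇⊢◇⇒⊢∇ : ∀ {n A B} → InF n A → InF n B → ◇[ n ] A ⊢ ◇[ n ] B → A ⊢ ∇[ n ] B
◇⊢◇⇒⊢∇ {n} {A} {B} A∈F B∈F d =
  subst₂ _⊢_ (erase-InF A∈F) (trans (erase-high {C = B} ≤-refl) (cong ∇[ n ]_ (erase-InF B∈F)))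
    (Model.Reach.reached (Model.◇⊢◇⇒Reach n A d))
  where open Erasure n

⊢∇⇒◇⊢◇ : ∀ {n A B} → A ⊢ ∇[ n ] B → ◇[ n ] A ⊢ ◇[ n ] B
⊢∇⇒◇⊢◇ {n} d = cut (mono (◇ n) d) (◇∇◇ ≤-refl)

corollary4 : (n : ℕ) (A B : Fm) → InF n A → InF n B →
    ((◇[ n ] A ⊢ ◇[ n ] B) → (A ⊢ ∇[ n ] B)) × ((A ⊢ ∇[ n ] B) → (◇[ n ] A ⊢ ◇[ n ] B))
corollary4 n A B A∈F B∈F = ◇⊢◇⇒⊢∇ A∈F B∈F , ⊢∇⇒◇⊢◇
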